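{- Let $\mathcal{T}_0=\{T^\flat,T^\dagger,T^\ddagger,T^\sharp\}$ and $\mathcal{T}_{k+1}=\{S\otimes T: S,T\in\mathcal{T}_k\}$ for $k\geqslant0$. For $k\geqslant0$ let $I_k=\{3\cdot 2^k+k+1,\,3\cdot2^k+k+2,\,\dots,\,6\cdot 2^k+k+1\}$. Then for every $k\geqslant 0$ the map $T\mapsto\delta(T)$ maps $\mathcal{T}_k$ onto $I_k$.
   Context: Let $S=\{0,1,*\}$; elements of $S^d$ are strings of length $d$. A list is a finite sequence of strings all of the same length (repetitions allowed); $|L|$ is its number of entries; $[x]$ is the one-entry list of the string $x$; $*^m$ is the string of $m$ jokers $*$. Operations: pairing $[v_1,\dots,v_n]\ominus[w_1,\dots,w_n]=[v_1w_1,\dots,v_nw_n]$; concatenation $AB=[v_iw_j]$ (all pairs, ordered lexicographically in $(i,j)$); sum $A+B$ = entries of $A$ followed by entries of $B$; $1\cdot A=A$, $(k+1)\cdot A=k\cdot A+A$; concatenation before sum. For a triple of lists $T=(A,B,C)$: $\alpha(T)$, $\beta(T)$ are the lengths of the strings in $A$, $B$; $\delta(T)=\alpha(T)+\beta(T)$; $g(T)=|C|$. The compound of triples $T=(A,B,C)$, $T'=(A',B',C')$ with $\alpha(T)=\alpha(T')$ is $T\otimes T'=(A'',B'',C'')$ with $A''=[0]A+[0]A'+[1]\big((g(T)g(T'))\cdot[*^{\alpha(T)}]\big)$, $B''=[0]B[*^{\beta(T')}]+[1][*^{\beta(T)}]B'+[*]CC'$, $C''=[0]C[*^{\beta(T')}]+[1][*^{\beta(T)}]C'$.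 Let $G=[0,1]$, $H=[00,01,1*]$, $L=[000,001,01*,1**]$. Define $T^\flat=(3\cdot[00]+3\cdot[01]+3\cdot[1*],\ 3\cdot H,\ H)$; $T^\dagger=(4\cdot[00]+4\cdot[01]+4\cdot[1*],\ 3\cdot L,\ L)$; $T^\ddagger=(2\cdot[00]+2\cdot[01]+3\cdot[00]+3\cdot[01]+6\cdot[1*],\ 2\cdot([0]G[**])+2\cdot([1][*]H)+[*]GH,\ [0]G[**]+[1][*]H)$; $T^\sharp=(2\cdot(3\cdot[00]+3\cdot[01])+9\cdot[1*],\ 2\cdot([0]H[**])+2\cdot([1][**]H)+[*]HH,\ [0]H[**]+[1][**]H)$. -}

module Defs where

open import Data.Nat using (ℕ; zero; suc; _+_; _*_; _^_; _≤_)
open import Data.List using (List; []; _∷_; _++_; concatMap; map; concat; replicate; length)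
open import Data.Vec using (Vec; []; _∷_) renaming (_++_ to _++ᵥ_)
open import Data.Product using (_×_)

data S : Set where
  s0 s1 joker : S

Lst : ℕ → Set
Lst d = List (Vec S d)

⟦_⟧ : ∀ {d} → Vec S d → Lst d
⟦ x ⟧ = x ∷ []

jokers : (m : ℕ) → Vec S m
jokers zero = []
jokers (suc m) = joker ∷ jokers m

infixl 7 _⊙_
_⊙_ : ∀ {m n} → Lst m → Lst n → Lst (m + n)
A ⊙ B = concatMap (λ v → map (λ w → v ++ᵥ w) B) A

infixl 6 _⊕_
_⊕_ : ∀ {d} → Lst d → Lst d → Lst d
A ⊕ B = A ++ B

infixl 8 _·_
_·_ : ∀ {d} → ℕ → Lst d → Lst d
k · A = concat (replicate k A)

record Triple (a : ℕ) : Set where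
  constructor triple
  field
    β : ℕ
    A : Lst a
    B : Lst β
    C : Lst β
open Triple public

α : ∀ {a} → Triple a → ℕ
α {a} _ = a

δ : ∀ {a} → Triple a → ℕ
δ T = α T + β T

g : ∀ {a} → Triple a → ℕ
g T = length (C T)

c0 c1 cj : Lst 1
c0 = ⟦ s0 ∷ [] ⟧
c1 = ⟦ s1 ∷ [] ⟧
cj = ⟦ joker ∷ [] ⟧

-- compound T ⊗ T' (defined when α(T) = α(T'), enforced by the index)
_⊗_ : ∀ {a} → Triple a → Triple a → Triple (suc a)
_⊗_ {a} T T' = triple (suc (β T + β T'))
  (c0 ⊙ A T ⊕ c0 ⊙ A T' ⊕ c1 ⊙ ((g T * g T') · ⟦ jokers a ⟧))
  (c0 ⊙ B T ⊙ ⟦ jokers (β T') ⟧ ⊕ c1 ⊙ ⟦ jokers (β T) ⟧ ⊙ B T' ⊕ cj ⊙ C T ⊙ C T')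
  (c0 ⊙ C T ⊙ ⟦ jokers (β T') ⟧ ⊕ c1 ⊙ ⟦ jokers (β T) ⟧ ⊙ C T')

G : Lst 1
G = (s0 ∷ []) ∷ (s1 ∷ []) ∷ []

H : Lst 2
H = (s0 ∷ s0 ∷ []) ∷ (s0 ∷ s1 ∷ []) ∷ (s1 ∷ joker ∷ []) ∷ []

L : Lst 3
L = (s0 ∷ s0 ∷ s0 ∷ []) ∷ (s0 ∷ s0 ∷ s1 ∷ []) ∷ (s0 ∷ s1 ∷ joker ∷ [])
    ∷ (s1 ∷ joker ∷ joker ∷ []) ∷ []

e00 e01 e1j : Lst 2
e00 = ⟦ s0 ∷ s0 ∷ [] ⟧
e01 = ⟦ s0 ∷ s1 ∷ [] ⟧
e1j = ⟦ s1 ∷ joker ∷ [] ⟧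

T♭ : Triple 2
T♭ = triple 2 (3 · e00 ⊕ 3 · e01 ⊕ 3 · e1j) (3 · H) H

T† : Triple 2
T† = triple 3 (4 · e00 ⊕ 4 · e01 ⊕ 4 · e1j) (3 · L) L

T‡ : Triple 2
T‡ = triple 4
  (2 · e00 ⊕ 2 · e01 ⊕ 3 · e00 ⊕ 3 · e01 ⊕ 6 · e1j)
  (2 · (c0 ⊙ G ⊙ ⟦ jokers 2 ⟧) ⊕ 2 · (c1 ⊙ cj ⊙ H) ⊕ cj ⊙ G ⊙ H)
  (c0 ⊙ G ⊙ ⟦ jokers 2 ⟧ ⊕ c1 ⊙ cj ⊙ H)

T♯ : Triple 2
T♯ = triple 5
  (2 · (3 · e00 ⊕ 3 · e01) ⊕ 9 · e1j)
  (2 · (c0 ⊙ H ⊙ ⟦ jokers 2 ⟧) ⊕ 2 · (c1 ⊙ ⟦ jokers 2 ⟧ ⊙ H) ⊕ cj ⊙ H ⊙ H)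
  (c0 ⊙ H ⊙ ⟦ jokers 2 ⟧ ⊕ c1 ⊙ ⟦ jokers 2 ⟧ ⊙ H)

𝒯 : (k : ℕ) → List (Triple (k + 2))
𝒯 zero = T♭ ∷ T† ∷ T‡ ∷ T♯ ∷ []
𝒯 (suc k) = concatMap (λ S → map (λ T → S ⊗ T) (𝒯 k)) (𝒯 k)

InI : ℕ → ℕ → Set
InI k n = (3 * 2 ^ k + k + 1 ≤ n) × (n ≤ 6 * 2 ^ k + k + 1)

{-# OPTIONS --safe #-}
-- The strings of B in S ⊗ T have length 1 + β S + β T, so the width β + 1 is
-- additive under ⊗.  The four base triples have widths 3, 4, 5, 6, and since
-- [l, h] + [l, h] = [2l, 2h] as sets of naturals, the widths of 𝒯 k fill exactly
-- [3·2^k, 6·2^k].  As α = k + 2 on 𝒯 k, δ is the width shifted by k + 1.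
module Submission where

open import Defs
open import Level using (Level)
open import Data.Nat using (ℕ; zero; suc; _+_; _*_; _^_; _∸_; _≤_; _≤?_; s≤s)
open import Data.Nat.Properties
open import Data.Nat.Tactic.RingSolver using (solve-∀)
open import Data.Product using (_×_; _,_; ∃-syntax; ∃₂)
open import Data.List using (List; []; _∷_; _++_; map; concatMap; cartesianProductWith)
open import Data.List.Membership.Propositional using (_∈_)
open import Data.List.Membership.Propositional.Properties
  using (∈-cartesianProductWith⁺; ∈-cartesianProductWith⁻)
open import Data.List.Relation.Unary.Any using (here; there)
open import Relation.Binary.PropositionalEquality using (_≡_; refl; sym; trans; cong; subst; subst₂; module ≡-Reasoning)
open import Relation.Nullary using (yes; no)

private
  variable
    ℓ₁ ℓ₂ ℓ₃ : Level
    X : Set ℓ₁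
    Y : Set ℓ₂
    Z : Set ℓ₃

concatMap-map≡cartesianProductWith : (f : X → Y → Z) (xs : List X) (ys : List Y) →
  concatMap (λ x → map (f x) ys) xs ≡ cartesianProductWith f xs ys
concatMap-map≡cartesianProductWith f []       ys = refl
concatMap-map≡cartesianProductWith f (x ∷ xs) ys =
  cong (map (f x) ys ++_) (concatMap-map≡cartesianProductWith f xs ys)

Between : ℕ → ℕ → ℕ → Set
Between l h n = l ≤ n × n ≤ h

Between-+ : ∀ {l₁ h₁ l₂ h₂ x y} → Between l₁ h₁ x → Between l₂ h₂ y →
  Between (l₁ + l₂) (h₁ + h₂) (x + y)
Between-+ (l₁≤x , x≤h₁) (l₂≤y , y≤h₂) = +-mono-≤ l₁≤x l₂≤y , +-mono-≤ x≤h₁ y≤h₂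

Between-+⁻ : ∀ {l₁ h₁ l₂ h₂ m} → l₁ ≤ h₁ → l₂ ≤ h₂ → Between (l₁ + l₂) (h₁ + h₂) m →
  ∃₂ λ x y → Between l₁ h₁ x × Between l₂ h₂ y × x + y ≡ m
-- Take x = l₁ unless that pushes y above h₂, in which case take y = h₂.
Between-+⁻ {l₁} {h₁} {l₂} {h₂} {m} l₁≤h₁ l₂≤h₂ (l≤m , m≤h) with m ≤? l₁ + h₂
... | yes m≤l₁+h₂ =
  l₁ , m ∸ l₁ , (≤-refl , l₁≤h₁) ,
  (m+n≤o⇒m≤o∸n l₂ (subst (_≤ m) (+-comm l₁ l₂) l≤m) , m≤n+o⇒m∸n≤o m l₁ m≤l₁+h₂) ,
  m+[n∸m]≡n (m+n≤o⇒m≤o l₁ l≤m)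
... | no m≰l₁+h₂ =
  m ∸ h₂ , h₂ , (m+n≤o⇒m≤o∸n l₁ l₁+h₂≤m , m≤n+o⇒m∸n≤o m h₂ (subst (m ≤_) (+-comm h₁ h₂) m≤h)) ,
  (l₂≤h₂ , ≤-refl) ,
  m∸n+n≡m (m+n≤o⇒n≤o l₁ l₁+h₂≤m)
  where
  l₁+h₂≤m : l₁ + h₂ ≤ m
  l₁+h₂≤m = <⇒≤ (≰⇒> m≰l₁+h₂)

Between-+ʳ : ∀ {l h n} d → Between l h n → Between (l + d) (h + d) (n + d)
Between-+ʳ d n∈ = Between-+ n∈ (≤-refl , ≤-refl)

Between-+ʳ⁻ : ∀ {l h n} d → Between (l + d) (h + d) n → ∃[ m ] Between l h m × m + d ≡ n
Between-+ʳ⁻ {l} {h} {n} d (l+d≤n , n≤h+d) =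
  n ∸ d , (m+n≤o⇒m≤o∸n l l+d≤n , m≤n+o⇒m∸n≤o n d (subst (n ≤_) (+-comm h d) n≤h+d)) ,
  m∸n+n≡m (m+n≤o⇒n≤o l l+d≤n)

*-2^-suc : ∀ m k → m * 2 ^ suc k ≡ m * 2 ^ k + m * 2 ^ k
*-2^-suc m k = begin
  m * (2 * 2 ^ k)           ≡⟨ cong (λ x → m * (2 ^ k + x)) (+-identityʳ (2 ^ k)) ⟩
  m * (2 ^ k + 2 ^ k)       ≡⟨ *-distribˡ-+ m (2 ^ k) (2 ^ k) ⟩
  m * 2 ^ k + m * 2 ^ k     ∎
  where open ≡-Reasoning

width : ∀ {a} → Triple a → ℕ
width T = suc (β T)

width-⊗ : ∀ {a} (S T : Triple a) → width (S ⊗ T) ≡ width S + width T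
width-⊗ S T = cong suc (sym (+-suc (β S) (β T)))

δ≡width+k+1 : ∀ k (T : Triple (k + 2)) → δ T ≡ width T + k + 1
δ≡width+k+1 k T = ring k (β T)
  where
  ring : ∀ k b → k + 2 + b ≡ suc b + k + 1
  ring = solve-∀

𝒯-suc : ∀ k → 𝒯 (suc k) ≡ cartesianProductWith _⊗_ (𝒯 k) (𝒯 k)
𝒯-suc k = concatMap-map≡cartesianProductWith _⊗_ (𝒯 k) (𝒯 k)

∈-𝒯-suc⁻ : ∀ k {T} → T ∈ 𝒯 (suc k) → ∃₂ λ S U → S ∈ 𝒯 k × U ∈ 𝒯 k × T ≡ S ⊗ U
∈-𝒯-suc⁻ k T∈ = ∈-cartesianProductWith⁻ _⊗_ (𝒯 k) (𝒯 k) (subst (_ ∈_) (𝒯-suc k) T∈)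

⊗-∈-𝒯-suc : ∀ k {S U} → S ∈ 𝒯 k → U ∈ 𝒯 k → S ⊗ U ∈ 𝒯 (suc k)
⊗-∈-𝒯-suc k {S} {U} S∈ U∈ = subst (S ⊗ U ∈_) (sym (𝒯-suc k)) (∈-cartesianProductWith⁺ _⊗_ S∈ U∈)

width-bounds : ∀ k {T} → T ∈ 𝒯 k → Between (3 * 2 ^ k) (6 * 2 ^ k) (width T)
width-bounds zero (here refl)                         = m≤m+n 3 0 , m≤m+n 3 3
width-bounds zero (there (here refl))                 = m≤m+n 3 1 , m≤m+n 4 2
width-bounds zero (there (there (here refl)))         = m≤m+n 3 2 , m≤m+n 5 1
width-bounds zero (there (there (there (here refl)))) = m≤m+n 3 3 , m≤m+n 6 0
width-bounds (suc k) T∈ with ∈-𝒯-suc⁻ k T∈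
... | S , U , S∈ , U∈ , refl =
  subst₂ (λ l h → Between l h (width (S ⊗ U))) (sym (*-2^-suc 3 k)) (sym (*-2^-suc 6 k))
    (subst (Between _ _) (sym (width-⊗ S U)) (Between-+ (width-bounds k S∈) (width-bounds k U∈)))

width-onto : ∀ k {m} → Between (3 * 2 ^ k) (6 * 2 ^ k) m → ∃[ T ] T ∈ 𝒯 k × width T ≡ m
width-onto zero {3} _ = T♭ , here refl , refl
width-onto zero {4} _ = T† , there (here refl) , refl
width-onto zero {5} _ = T‡ , there (there (here refl)) , refl
width-onto zero {6} _ = T♯ , there (there (there (here refl))) , refl
width-onto zero {0} (() , _)
width-onto zero {1} (s≤s () , _)
width-onto zero {2} (s≤s (s≤s ()) , _)
width-onto zero {suc (suc (suc (suc (suc (suc (suc _))))))}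
  (_ , s≤s (s≤s (s≤s (s≤s (s≤s (s≤s ()))))))
width-onto (suc k) {m} m∈
  with Between-+⁻ 3·2^k≤6·2^k 3·2^k≤6·2^k
         (subst₂ (λ l h → Between l h m) (*-2^-suc 3 k) (*-2^-suc 6 k) m∈)
  where
  3·2^k≤6·2^k : 3 * 2 ^ k ≤ 6 * 2 ^ k
  3·2^k≤6·2^k = *-monoˡ-≤ (2 ^ k) (m≤m+n 3 3)
... | x , y , x∈ , y∈ , x+y≡m with width-onto k x∈ | width-onto k y∈
... | S , S∈ , refl | U , U∈ , refl =
  S ⊗ U , ⊗-∈-𝒯-suc k S∈ U∈ , trans (width-⊗ S U) x+y≡m

proposition8 : (k : ℕ)
    → ((T : Triple (k + 2)) → T ∈ 𝒯 k → InI k (δ T))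
    × ((n : ℕ) → InI k n → ∃[ T ] (T ∈ 𝒯 k × δ T ≡ n))
proposition8 k = δ-into , δ-onto
  where
  δ-into : (T : Triple (k + 2)) → T ∈ 𝒯 k → InI k (δ T)
  δ-into T T∈ = subst (InI k) (sym (δ≡width+k+1 k T))
    (Between-+ʳ 1 (Between-+ʳ k (width-bounds k T∈)))

  δ-onto : (n : ℕ) → InI k n → ∃[ T ] (T ∈ 𝒯 k × δ T ≡ n)
  δ-onto n n∈ with Between-+ʳ⁻ 1 n∈
  ... | _ , m+k∈ , refl with Between-+ʳ⁻ k m+k∈
  ... | _ , m∈ , refl with width-onto k m∈
  ... | T , T∈ , refl = T , T∈ , δ≡width+k+1 k T
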